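{- Let $n \geq 1$ and let $G_n$ be the strip graph. The divisor $D = 3v_0 + 2v_1$ on $G_n$ has rank at least $1$.
   Context: The strip graph $G_n$ has vertices $v_0,\ldots,v_n$ and an edge between $v_i$ and $v_j$ exactly when $|i-j|\in\{1,2\}$. Divisors are integer combinations of vertices, equivalent when their difference lies in the image of the graph Laplacian ($\Delta_{ii}=\operatorname{val}(v_i)$, $\Delta_{ij}=-$number of edges between $v_i,v_j$). The rank of $D$ is $-1$ if $D$ is not equivalent to an effective divisor, otherwise the largest $r$ such that $D-E$ is equivalent to an effective divisor for every effective divisor $E$ of degree $r$. -}

module Defs where

open import Data.Nat as ℕ using (ℕ; zero; suc)
open import Data.Fin using (Fin; toℕ)
open import Data.Integer as ℤ using (ℤ; +_; _-_; _*_; _+_; _≤_)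
open import Data.Product using (Σ; ∃; _×_; _,_)
open import Relation.Binary.PropositionalEquality using (_≡_)
open import Data.Vec.Functional using (foldr)

dist : ℕ → ℕ → ℕ
dist i j = ℕ.∣ i - j ∣
  where open import Data.Nat using (∣_-_∣)

-- Strip graph G_n : vertices v_0 … v_n are Fin (suc n); number of edges
-- between v_i and v_j is 1 if |i-j| ∈ {1,2} and 0 otherwise.
edges : ℕ → ℕ → ℤ
edges i j with dist i j
... | 1 = + 1
... | 2 = + 1
... | _ = + 0

Σℤ : ∀ {m} → (Fin m → ℤ) → ℤ
Σℤ = foldr _+_ (+ 0)

Divisor : ℕ → Set
Divisor n = Fin (suc n) → ℤ

-- Laplacian Δ applied to an integer vector f:
-- (Δ f)_i = val(v_i) f_i - Σ_{j≠i} #edges(v_i,v_j) f_j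
--         = Σ_j #edges(v_i,v_j) (f_i - f_j)   (no loops since edges i i = 0)
laplacian : ∀ n → (Fin (suc n) → ℤ) → Divisor n
laplacian n f i = Σℤ (λ j → edges (toℕ i) (toℕ j) * (f i - f j))

_∼_ : ∀ {n} → Divisor n → Divisor n → Set
_∼_ {n} D D' = ∃ λ (f : Fin (suc n) → ℤ) → ∀ i → D i - D' i ≡ laplacian n f i

Effective : ∀ {n} → Divisor n → Set
Effective D = ∀ i → + 0 ≤ D i

HasEffective : ∀ {n} → Divisor n → Set
HasEffective {n} D = Σ (Divisor n) λ D' → Effective D' × (D ∼ D')

deg : ∀ {n} → Divisor n → ℤ
deg D = Σℤ D

-- rank D ≥ r  (for r : ℕ): for every effective E of degree r, D - E is
-- equivalent to an effective divisor.  (For r = 0 this says rank ≠ -1.)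
RankAtLeast : ∀ {n} → Divisor n → ℕ → Set
RankAtLeast {n} D r =
  (E : Divisor n) → Effective E → deg E ≡ + r → HasEffective (λ i → D i - E i)

D32 : ∀ n → Divisor n
D32 n i with toℕ i
... | 0 = + 3
... | 1 = + 2
... | _ = + 0

-- An effective divisor of degree 1 lies below a single vertex v_k, and D − v_k is already
-- effective when k ≤ 1. For 1 ≤ c < n the ramp f(j) = max(c − j, 0) is affine on v_0 … v_c and
-- constant from v_c on, so its Laplacian is concentrated at v_0, v_1 and around v_c; in fact
-- D − Δf = v_{c−1} + 3 v_c + v_{c+1}. For k ≥ 2 this divisor contains v_k when c = k < n, or
-- when c = n − 1 and k = n.
{-# OPTIONS --safe #-}
module Submission where

open import Defs
open import Data.Nat as ℕ using (ℕ; _≥_; zero; suc; z≤n; s≤s; _∸_; _<?_)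
import Data.Nat.Properties as ℕP
open import Data.Fin using (Fin; toℕ; zero; suc)
import Data.Fin.Properties as FP
open import Data.Integer using (ℤ; +_; -[1+_]; _-_; _*_; _+_; _≤_; +≤+)
import Data.Integer.Properties as ℤP
open import Data.Product using (∃; _,_)
open import Data.Sum using (_⊎_; inj₁; inj₂)
open import Function using (_∘_)
open import Relation.Nullary using (yes; no)
open import Relation.Binary.PropositionalEquality
open import Data.Integer.Tactic.RingSolver using (solve-∀)
open ≡-Reasoning

sumFrom : ℕ → ℕ → (ℕ → ℤ) → ℤ
sumFrom k zero    g = + 0
sumFrom k (suc m) g = g k + sumFrom (suc k) m g

sumFrom-shift : ∀ k m (g : ℕ → ℤ) → sumFrom k m (g ∘ suc) ≡ sumFrom (suc k) m g
sumFrom-shift k zero    g = refl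
sumFrom-shift k (suc m) g = cong (_+_ (g (suc k))) (sumFrom-shift (suc k) m g)

Σℤ-toℕ : ∀ m (g : ℕ → ℤ) → Σℤ {m} (g ∘ toℕ) ≡ sumFrom 0 m g
Σℤ-toℕ zero    g = refl
Σℤ-toℕ (suc m) g = cong (_+_ (g 0)) (trans (Σℤ-toℕ m (g ∘ suc)) (sumFrom-shift 0 m g))

sumFrom-+ : ∀ k a m (g : ℕ → ℤ) → sumFrom k (a ℕ.+ m) g ≡ sumFrom k a g + sumFrom (k ℕ.+ a) m g
sumFrom-+ k zero    m g rewrite ℕP.+-identityʳ k = sym (ℤP.+-identityˡ _)
sumFrom-+ k (suc a) m g rewrite sumFrom-+ (suc k) a m g | ℕP.+-suc k a =
  sym (ℤP.+-assoc (g k) _ _)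

sumFrom-zero : ∀ k m (g : ℕ → ℤ) → (∀ j → k ℕ.≤ j → j ℕ.< k ℕ.+ m → g j ≡ + 0) →
               sumFrom k m g ≡ + 0
sumFrom-zero k zero    g g≡0 = refl
sumFrom-zero k (suc m) g g≡0 = cong₂ _+_
  (g≡0 k ℕP.≤-refl (ℕP.m<m+n k (s≤s z≤n)))
  (sumFrom-zero (suc k) m g λ j k<j j<k+m →
    g≡0 j (ℕP.<⇒≤ k<j) (subst (j ℕ.<_) (sym (ℕP.+-suc k m)) j<k+m))

dist-+ʳ : ∀ k i → dist i (k ℕ.+ i) ≡ k
dist-+ʳ k i = trans (cong (dist i) (ℕP.+-comm k i)) (ℕP.∣m-m+n∣≡n i k)

dist-+ˡ : ∀ k i → dist (k ℕ.+ i) i ≡ k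
dist-+ˡ k i = trans (ℕP.∣-∣-comm (k ℕ.+ i) i) (dist-+ʳ k i)

dist-far : ∀ i j → 3 ℕ.+ i ℕ.≤ j → 3 ℕ.≤ dist i j
dist-far i j 3+i≤j = subst (3 ℕ.≤_) (sym (ℕP.m≤n⇒∣m-n∣≡n∸m (ℕP.m+n≤o⇒n≤o 3 3+i≤j)))
  (ℕP.m+n≤o⇒m≤o∸n 3 3+i≤j)

edges-adjacent : ∀ i j → dist i j ≡ 1 ⊎ dist i j ≡ 2 → edges i j ≡ + 1
edges-adjacent i j d∈12 with dist i j | d∈12
... | _ | inj₁ refl = refl
... | _ | inj₂ refl = refl

edges-nonadjacent : ∀ i j → dist i j ≡ 0 ⊎ 3 ℕ.≤ dist i j → edges i j ≡ + 0
edges-nonadjacent i j d∉12 with dist i j | d∉12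
... | _                 | inj₁ refl                       = refl
... | suc (suc (suc _)) | inj₂ (s≤s (s≤s (s≤s _))) = refl

Δterm : (ℕ → ℤ) → ℕ → ℕ → ℤ
Δterm F i j = edges i j * (F i - F j)

Δterm-adjacent : ∀ F i j → dist i j ≡ 1 ⊎ dist i j ≡ 2 → Δterm F i j ≡ F i - F j
Δterm-adjacent F i j d∈12 =
  trans (cong (_* (F i - F j)) (edges-adjacent i j d∈12)) (ℤP.*-identityˡ _)

Δterm-nonadjacent : ∀ F i j → dist i j ≡ 0 ⊎ 3 ℕ.≤ dist i j → Δterm F i j ≡ + 0
Δterm-nonadjacent F i j d∉12 = cong (_* (F i - F j)) (edges-nonadjacent i j d∉12)

leftΔ : (ℕ → ℤ) → ℕ → ℤ
leftΔ F zero          = + 0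
leftΔ F (suc zero)    = F 1 - F 0
leftΔ F (suc (suc a)) = (F (2 ℕ.+ a) - F a) + (F (2 ℕ.+ a) - F (1 ℕ.+ a))

-- r is the number of vertices to the right of v_i, so only min r 2 of them are neighbours.
rightΔ : (ℕ → ℤ) → ℕ → ℕ → ℤ
rightΔ F i zero          = + 0
rightΔ F i (suc zero)    = F i - F (1 ℕ.+ i)
rightΔ F i (suc (suc r)) = (F i - F (1 ℕ.+ i)) + (F i - F (2 ℕ.+ i))

sumFrom-rightΔ : ∀ F i r → sumFrom (suc i) r (Δterm F i) ≡ rightΔ F i r
sumFrom-rightΔ F i zero          = refl
sumFrom-rightΔ F i (suc zero)    =
  trans (ℤP.+-identityʳ _) (Δterm-adjacent F i (1 ℕ.+ i) (inj₁ (dist-+ʳ 1 i)))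
sumFrom-rightΔ F i (suc (suc r)) = begin
  Δterm F i (1 ℕ.+ i) + (Δterm F i (2 ℕ.+ i) + sumFrom (3 ℕ.+ i) r (Δterm F i))
    ≡⟨ cong₂ _+_ (Δterm-adjacent F i (1 ℕ.+ i) (inj₁ (dist-+ʳ 1 i)))
                 (cong₂ _+_ (Δterm-adjacent F i (2 ℕ.+ i) (inj₂ (dist-+ʳ 2 i))) beyond) ⟩
  (F i - F (1 ℕ.+ i)) + ((F i - F (2 ℕ.+ i)) + + 0)
    ≡⟨ cong (_+_ (F i - F (1 ℕ.+ i))) (ℤP.+-identityʳ _) ⟩
  rightΔ F i (suc (suc r)) ∎
  where
  beyond : sumFrom (3 ℕ.+ i) r (Δterm F i) ≡ + 0
  beyond = sumFrom-zero (3 ℕ.+ i) r (Δterm F i)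
    λ j 3+i≤j _ → Δterm-nonadjacent F i j (inj₂ (dist-far i j 3+i≤j))

sumFrom-Δterm : ∀ F i r → sumFrom 0 (suc (i ℕ.+ r)) (Δterm F i) ≡ leftΔ F i + rightΔ F i r
sumFrom-Δterm F zero          r = cong (_+_ (+ 0)) (sumFrom-rightΔ F 0 r)
sumFrom-Δterm F (suc zero)    r =
  cong₂ _+_ (ℤP.*-identityˡ (F 1 - F 0)) (trans (ℤP.+-identityˡ _) (sumFrom-rightΔ F 1 r))
sumFrom-Δterm F (suc (suc a)) r = begin
  sumFrom 0 (3 ℕ.+ (a ℕ.+ r)) g
    ≡⟨ cong (λ m → sumFrom 0 m g) (trans (cong (ℕ._+ r) (ℕP.+-comm 3 a)) (ℕP.+-assoc a 3 r)) ⟩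
  sumFrom 0 (a ℕ.+ (3 ℕ.+ r)) g
    ≡⟨ sumFrom-+ 0 a (3 ℕ.+ r) g ⟩
  sumFrom 0 a g + (g a + (g (1 ℕ.+ a) + (g i + sumFrom (suc i) r g)))
    ≡⟨ cong₂ _+_ before (cong₂ _+_ (Δterm-adjacent F i a (inj₂ (dist-+ˡ 2 a)))
         (cong₂ _+_ (Δterm-adjacent F i (1 ℕ.+ a) (inj₁ (dist-+ˡ 1 a)))
           (cong₂ _+_ (Δterm-nonadjacent F i i (inj₁ (ℕP.∣n-n∣≡0 i))) (sumFrom-rightΔ F i r)))) ⟩
  + 0 + ((F i - F a) + ((F i - F (1 ℕ.+ a)) + (+ 0 + rightΔ F i r)))
    ≡⟨ ℤP.+-identityˡ _ ⟩
  (F i - F a) + ((F i - F (1 ℕ.+ a)) + (+ 0 + rightΔ F i r))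
    ≡⟨ cong (λ t → (F i - F a) + ((F i - F (1 ℕ.+ a)) + t)) (ℤP.+-identityˡ _) ⟩
  (F i - F a) + ((F i - F (1 ℕ.+ a)) + rightΔ F i r)
    ≡⟨ ℤP.+-assoc (F i - F a) _ _ ⟨
  leftΔ F i + rightΔ F i r ∎
  where
  i = 2 ℕ.+ a
  g = Δterm F i
  before : sumFrom 0 a g ≡ + 0
  before = sumFrom-zero 0 a g λ j _ j<a → Δterm-nonadjacent F i j
    (inj₂ (subst (3 ℕ.≤_) (ℕP.∣-∣-comm j i) (dist-far j i (s≤s (s≤s j<a)))))

laplacian-local : ∀ n F (i : Fin (suc n)) →
  laplacian n (F ∘ toℕ) i ≡ leftΔ F (toℕ i) + rightΔ F (toℕ i) (n ∸ toℕ i)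
laplacian-local n F i = begin
  laplacian n (F ∘ toℕ) i            ≡⟨ Σℤ-toℕ (suc n) (Δterm F (toℕ i)) ⟩
  sumFrom 0 (suc n) (Δterm F (toℕ i)) ≡⟨ cong (λ m → sumFrom 0 (suc m) (Δterm F (toℕ i))) i+[n∸i]≡n ⟨
  sumFrom 0 (suc (toℕ i ℕ.+ (n ∸ toℕ i))) (Δterm F (toℕ i)) ≡⟨ sumFrom-Δterm F (toℕ i) (n ∸ toℕ i) ⟩
  leftΔ F (toℕ i) + rightΔ F (toℕ i) (n ∸ toℕ i) ∎
  where
  i+[n∸i]≡n : toℕ i ℕ.+ (n ∸ toℕ i) ≡ n
  i+[n∸i]≡n = ℕP.m+[n∸m]≡n (FP.toℕ≤pred[n] i)

ramp : ℕ → ℕ → ℤ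
ramp c j = + (c ∸ j)

D₃₂ : ℕ → ℤ
D₃₂ zero          = + 3
D₃₂ (suc zero)    = + 2
D₃₂ (suc (suc _)) = + 0

-- spread c = v_{c-1} + 3 v_c + v_{c+1}, written so that spread (1 + c) (1 + i) = spread c i.
spread : ℕ → ℕ → ℤ
spread (suc c)       (suc i)       = spread c i
spread zero          zero          = + 3
spread zero          (suc zero)    = + 1
spread zero          (suc (suc _)) = + 0
spread (suc zero)    zero          = + 1
spread (suc (suc _)) zero          = + 0

-- The Laplacian on the infinite strip G_∞, where every vertex has two neighbours to its right.
Δ∞ : (ℕ → ℤ) → ℕ → ℤ
Δ∞ F i = leftΔ F i + rightΔ F i 2

Δ∞-ramp-0 : ∀ c → 1 ℕ.≤ c → Δ∞ (ramp c) 0 ≡ D₃₂ 0 - spread c 0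
Δ∞-ramp-0 1                   _ = refl
Δ∞-ramp-0 2                   _ = refl
Δ∞-ramp-0 (suc (suc (suc x))) _ = affine (+ x)
  where
  affine : ∀ x → + 0 + ((+ 3 + x - (+ 2 + x)) + (+ 3 + x - (+ 1 + x))) ≡ + 3 - + 0
  affine = solve-∀

Δ∞-ramp-1 : ∀ c → 1 ℕ.≤ c → Δ∞ (ramp c) 1 ≡ D₃₂ 1 - spread c 1
Δ∞-ramp-1 1                         _ = refl
Δ∞-ramp-1 2                         _ = refl
Δ∞-ramp-1 3                         _ = refl
Δ∞-ramp-1 (suc (suc (suc (suc x)))) _ = affine (+ x)
  where
  affine : ∀ x → (+ 3 + x - (+ 4 + x)) + ((+ 3 + x - (+ 2 + x)) + (+ 3 + x - (+ 1 + x))) ≡ + 2 - + 0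
  affine = solve-∀

Δ∞-ramp-2+ : ∀ a c → Δ∞ (ramp c) (2 ℕ.+ a) ≡ D₃₂ (2 ℕ.+ a) - spread c (2 ℕ.+ a)
Δ∞-ramp-2+ zero    0                               = refl
Δ∞-ramp-2+ zero    1                               = refl
Δ∞-ramp-2+ zero    2                               = refl
Δ∞-ramp-2+ zero    3                               = refl
Δ∞-ramp-2+ zero    4                               = refl
Δ∞-ramp-2+ zero    (suc (suc (suc (suc (suc x))))) = affine (+ x)
  where
  affine : ∀ x → ((+ 3 + x - (+ 5 + x)) + (+ 3 + x - (+ 4 + x)))
                 + ((+ 3 + x - (+ 2 + x)) + (+ 3 + x - (+ 1 + x))) ≡ + 0 - + 0
  affine = solve-∀
Δ∞-ramp-2+ (suc a) zero    = refl
-- Shifting c and i together leaves ramp, spread and D₃₂ (from v_2 on) unchanged definitionally.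
Δ∞-ramp-2+ (suc a) (suc c) = Δ∞-ramp-2+ a c

Δ∞-ramp : ∀ c i → 1 ℕ.≤ c → Δ∞ (ramp c) i ≡ D₃₂ i - spread c i
Δ∞-ramp c zero          1≤c = Δ∞-ramp-0 c 1≤c
Δ∞-ramp c (suc zero)    1≤c = Δ∞-ramp-1 c 1≤c
Δ∞-ramp c (suc (suc a)) _   = Δ∞-ramp-2+ a c

ramp-beyond : ∀ {c j} → c ℕ.≤ j → ramp c j ≡ + 0
ramp-beyond c≤j = cong +_ (ℕP.m≤n⇒m∸n≡0 c≤j)

rightΔ-ramp-beyond : ∀ {c i} → c ℕ.≤ i → ∀ r → rightΔ (ramp c) i r ≡ + 0
rightΔ-ramp-beyond c≤i zero          = refl
rightΔ-ramp-beyond c≤i (suc zero)    = cong₂ _-_ (ramp-beyond c≤i) (ramp-beyond c≤1+i)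
  where c≤1+i = ℕP.m≤n⇒m≤1+n c≤i
rightΔ-ramp-beyond c≤i (suc (suc r)) = cong₂ _+_
  (cong₂ _-_ (ramp-beyond c≤i) (ramp-beyond c≤1+i))
  (cong₂ _-_ (ramp-beyond c≤i) (ramp-beyond (ℕP.m≤n⇒m≤1+n c≤1+i)))
  where c≤1+i = ℕP.m≤n⇒m≤1+n c≤i

rightΔ-ramp : ∀ c i r → c ℕ.< i ℕ.+ r → rightΔ (ramp c) i r ≡ rightΔ (ramp c) i 2
rightΔ-ramp c i zero          c<i+0 = trans (rightΔ-ramp-beyond c≤i 0) (sym (rightΔ-ramp-beyond c≤i 2))
  where c≤i = ℕP.<⇒≤ (subst (c ℕ.<_) (ℕP.+-identityʳ i) c<i+0)
rightΔ-ramp c i (suc zero)    c<i+1 = trans (rightΔ-ramp-beyond c≤i 1) (sym (rightΔ-ramp-beyond c≤i 2))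
  where c≤i = ℕ.s≤s⁻¹ (subst (c ℕ.<_) (ℕP.+-comm i 1) c<i+1)
rightΔ-ramp c i (suc (suc r)) _     = refl

D32≡D₃₂ : ∀ n (i : Fin (suc n)) → D32 n i ≡ D₃₂ (toℕ i)
D32≡D₃₂ n i with toℕ i
... | zero          = refl
... | suc zero      = refl
... | suc (suc _)   = refl

D32∼spread : ∀ n c → 1 ℕ.≤ c → c ℕ.< n → D32 n ∼ (λ i → spread c (toℕ i))
D32∼spread n c 1≤c c<n = ramp c ∘ toℕ , λ i → begin
  D32 n i - spread c (toℕ i)
    ≡⟨ cong (_- spread c (toℕ i)) (D32≡D₃₂ n i) ⟩
  D₃₂ (toℕ i) - spread c (toℕ i)
    ≡⟨ Δ∞-ramp c (toℕ i) 1≤c ⟨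
  Δ∞ (ramp c) (toℕ i)
    ≡⟨ cong (_+_ (leftΔ (ramp c) (toℕ i))) (rightΔ-ramp c (toℕ i) (n ∸ toℕ i) (c<i+[n∸i] i)) ⟨
  leftΔ (ramp c) (toℕ i) + rightΔ (ramp c) (toℕ i) (n ∸ toℕ i)
    ≡⟨ laplacian-local n (ramp c) i ⟨
  laplacian n (ramp c ∘ toℕ) i ∎
  where
  c<i+[n∸i] : ∀ i → c ℕ.< toℕ i ℕ.+ (n ∸ toℕ i)
  c<i+[n∸i] i = subst (c ℕ.<_) (sym (ℕP.m+[n∸m]≡n (FP.toℕ≤pred[n] i))) c<n

laplacian-zero : ∀ n (i : Fin (suc n)) → laplacian n (λ _ → + 0) i ≡ + 0
laplacian-zero n i = trans (Σℤ-toℕ (suc n) (Δterm (λ _ → + 0) (toℕ i)))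
  (sumFrom-zero 0 (suc n) _ λ j _ _ → ℤP.*-zeroʳ (edges (toℕ i) j))

∼-refl : ∀ {n} {D : Divisor n} → D ∼ D
∼-refl {n} {D} = (λ _ → + 0) , λ i → trans (ℤP.+-inverseʳ (D i)) (sym (laplacian-zero n i))

∼⇒HasEffective-minus : ∀ {n} {D D′ E : Divisor n} → D ∼ D′ → (∀ i → E i ≤ D′ i) →
                       HasEffective (λ i → D i - E i)
∼⇒HasEffective-minus {D = D} {D′} {E} (f , D-D′≡Δf) E≤D′ =
  (λ i → D′ i - E i) , (λ i → ℤP.i≤j⇒0≤j-i (E≤D′ i)) ,
  f , λ i → trans (cancel (D i) (D′ i) (E i)) (D-D′≡Δf i)
  where
  cancel : ∀ x y z → (x - z) - (y - z) ≡ x - y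
  cancel = solve-∀

point : ℕ → ℕ → ℤ
point zero    zero    = + 1
point zero    (suc _) = + 0
point (suc k) zero    = + 0
point (suc k) (suc j) = point k j

Σℤ-nonneg : ∀ {m} (E : Fin m → ℤ) → (∀ i → + 0 ≤ E i) → + 0 ≤ Σℤ E
Σℤ-nonneg {zero}  E E≥0 = ℤP.≤-refl
Σℤ-nonneg {suc m} E E≥0 = ℤP.+-mono-≤ (E≥0 zero) (Σℤ-nonneg (E ∘ suc) (E≥0 ∘ suc))

≤-Σℤ : ∀ {m} (E : Fin m → ℤ) → (∀ i → + 0 ≤ E i) → ∀ i → E i ≤ Σℤ E
≤-Σℤ E E≥0 zero    = subst (_≤ E zero + Σℤ (E ∘ suc)) (ℤP.+-identityʳ (E zero))
  (ℤP.+-monoʳ-≤ (E zero) (Σℤ-nonneg (E ∘ suc) (E≥0 ∘ suc)))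
≤-Σℤ E E≥0 (suc i) = ℤP.≤-trans (≤-Σℤ (E ∘ suc) (E≥0 ∘ suc) i)
  (subst (_≤ E zero + Σℤ (E ∘ suc)) (ℤP.+-identityˡ (Σℤ (E ∘ suc)))
    (ℤP.+-monoˡ-≤ (Σℤ (E ∘ suc)) (E≥0 zero)))

Σℤ≡1⇒≤point : ∀ {m} (E : Fin m → ℤ) → (∀ i → + 0 ≤ E i) → Σℤ E ≡ + 1 →
              ∃ λ (k : Fin m) → ∀ i → E i ≤ point (toℕ k) (toℕ i)
Σℤ≡1⇒≤point {zero}  E E≥0 ()
Σℤ≡1⇒≤point {suc m} E E≥0 ΣE≡1 =
  split (E zero) (Σℤ (E ∘ suc)) refl refl (E≥0 zero) (Σℤ-nonneg (E ∘ suc) (E≥0 ∘ suc)) ΣE≡1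
  where
  split : ∀ e t → E zero ≡ e → Σℤ (E ∘ suc) ≡ t → + 0 ≤ e → + 0 ≤ t → e + t ≡ + 1 →
          ∃ λ (k : Fin (suc m)) → ∀ i → E i ≤ point (toℕ k) (toℕ i)
  split (+ 0) t E₀≡0 Σtail≡t _ _ 0+t≡1 =
    let k , E≤point = Σℤ≡1⇒≤point (E ∘ suc) (E≥0 ∘ suc)
                        (trans Σtail≡t (trans (sym (ℤP.+-identityˡ t)) 0+t≡1))
    in suc k , λ { zero → ℤP.≤-reflexive E₀≡0 ; (suc i) → E≤point i }
  split (+ 1) (+ 0) E₀≡1 Σtail≡0 _ _ _ =
    zero , λ { zero → ℤP.≤-reflexive E₀≡1
             ; (suc i) → subst (E (suc i) ≤_) Σtail≡0 (≤-Σℤ (E ∘ suc) (E≥0 ∘ suc) i) }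
  split (+ 1)           (+ suc _) _ _ _ _ ()
  split (+ suc (suc _)) (+ _)     _ _ _ _ ()
  split _               -[1+ _ ]  _ _ _ () _
  split -[1+ _ ]        _         _ _ () _ _

point≤D₃₂ : ∀ k i → k ℕ.≤ 1 → point k i ≤ D₃₂ i
point≤D₃₂ 0 zero          _ = +≤+ (s≤s z≤n)
point≤D₃₂ 0 (suc zero)    _ = +≤+ z≤n
point≤D₃₂ 0 (suc (suc _)) _ = +≤+ z≤n
point≤D₃₂ 1 zero          _ = +≤+ z≤n
point≤D₃₂ 1 (suc zero)    _ = +≤+ (s≤s z≤n)
point≤D₃₂ 1 (suc (suc _)) _ = +≤+ z≤n
point≤D₃₂ (suc (suc _)) _ (s≤s ())

spread≥0 : ∀ c i → + 0 ≤ spread c i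
spread≥0 (suc c)       (suc i)       = spread≥0 c i
spread≥0 zero          zero          = +≤+ z≤n
spread≥0 zero          (suc zero)    = +≤+ z≤n
spread≥0 zero          (suc (suc _)) = +≤+ z≤n
spread≥0 (suc zero)    zero          = +≤+ z≤n
spread≥0 (suc (suc _)) zero          = +≤+ z≤n

point≤spread : ∀ c i → point c i ≤ spread c i
point≤spread (suc c) (suc i)       = point≤spread c i
point≤spread zero    zero          = +≤+ (s≤s z≤n)
point≤spread zero    (suc i)       = spread≥0 zero (suc i)
point≤spread (suc c) zero          = spread≥0 (suc c) zero

point-suc≤spread : ∀ c i → point (suc c) i ≤ spread c i
point-suc≤spread (suc c) (suc i)       = point-suc≤spread c i
point-suc≤spread zero    zero          = spread≥0 zero zero
point-suc≤spread zero    (suc zero)    = ℤP.≤-refl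
point-suc≤spread zero    (suc (suc _)) = ℤP.≤-refl
point-suc≤spread (suc c) zero          = spread≥0 (suc c) zero

point≤D32 : ∀ n k → k ℕ.≤ 1 → ∀ i → point k (toℕ i) ≤ D32 n i
point≤D32 n k k≤1 i =
  subst (point k (toℕ i) ≤_) (sym (D32≡D₃₂ n i)) (point≤D₃₂ k (toℕ i) k≤1)

≤point⇒HasEffective-D32-minus : ∀ n (E : Divisor n) k → k ℕ.≤ n →
                                (∀ i → E i ≤ point k (toℕ i)) → HasEffective (λ i → D32 n i - E i)
≤point⇒HasEffective-D32-minus n E 0 _ E≤point = ∼⇒HasEffective-minus {D = D32 n} (∼-refl {D = D32 n})
  λ i → ℤP.≤-trans (E≤point i) (point≤D32 n 0 z≤n i)
≤point⇒HasEffective-D32-minus n E 1 _ E≤point = ∼⇒HasEffective-minus {D = D32 n} (∼-refl {D = D32 n})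
  λ i → ℤP.≤-trans (E≤point i) (point≤D32 n 1 (s≤s z≤n) i)
≤point⇒HasEffective-D32-minus n E k@(suc (suc k′)) k≤n E≤point with k <? n
... | yes k<n = ∼⇒HasEffective-minus {D = D32 n} (D32∼spread n k (s≤s z≤n) k<n)
                  λ i → ℤP.≤-trans (E≤point i) (point≤spread k (toℕ i))
... | no  _   = ∼⇒HasEffective-minus {D = D32 n} (D32∼spread n (suc k′) (s≤s z≤n) k≤n)
                  λ i → ℤP.≤-trans (E≤point i) (point-suc≤spread (suc k′) (toℕ i))

lemma6p2 : (n : ℕ) → n ≥ 1 → RankAtLeast (D32 n) 1
lemma6p2 n _ E E≥0 degE≡1 =
  let k , E≤point = Σℤ≡1⇒≤point E E≥0 degE≡1
  in ≤point⇒HasEffective-D32-minus n E (toℕ k) (FP.toℕ≤pred[n] k) E≤point
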